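{- Let $F:\mathcal C\to\mathcal S$ be a functor with $\mathcal C$ small, $Y:\mathcal C\to\mathcal P$ the displayed Yoneda embedding and $G:\mathcal P\to\mathcal S$ the projection. Let $M$ be a presheaf on $\mathcal C$ and $N$ an $\omega$-small dependent presheaf over $M$. For every object $c$ of $\mathcal P$, every $\alpha\in(Y_*M)(c)$ and every representation $(c',\ \mathsf p:c'\to c,\ \mathsf q)$ of the presheaf $(Y_*N)_{|\alpha}$ on $\mathcal P/c$, the morphism $G(\mathsf p)$ is an isomorphism in $\mathcal S$; that is, the unique map from $Y_*N$ to the terminal dependent presheaf preserves context extensions.
   Context: The displayed presheaf category $\mathcal P$: objects are pairs $(\Gamma,\Gamma^{\dagger})$ with $\Gamma\in\mathcal S$ and $\Gamma^{\dagger}$ a presheaf assigning an $\omega$-small set $\Gamma^{\dagger}(\Theta,\gamma)$ to every $\Theta\in\mathcal C$ and $\gamma\in\mathcal S(F\Theta,\Gamma)$, contravariantly in $(\Theta,\gamma)$; morphisms $(\Gamma,\Gamma^{\dagger})\to(\Delta,\Delta^{\dagger})$ are pairs of $f\in\mathcal S(\Gamma,\Delta)$ and a natural family of maps $\Gamma^{\dagger}(\Theta,\gamma)\to\Delta^{\dagger}(\Theta,f\circ\gamma)$; $G(\Gamma,\Gamma^{\dagger})=\Gamma$. $Y$ sends $\Gamma$ to $(F\Gamma,\ (\Theta,\gamma)\mapsto\{\rho\in\mathcal C(\Theta,\Gamma)\mid F\rho=\gamma\})$. $Y_*$ is the right adjoint of precomposition with $Y$: $(Y_*M)(c)$ is the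 set of families $\alpha(\Theta,u)\in M(\Theta)$ for $\Theta\in\mathcal C$, $u\in\mathcal P(Y\Theta,c)$, with $\alpha(\Theta',u\circ Y\sigma)=\alpha(\Theta,u)[\sigma]$; $(Y_*N)_c(\alpha)$ is the set of compatible families $\beta(\Theta,u)\in N_\Theta(\alpha(\Theta,u))$. For $\alpha\in(Y_*M)(c)$, $(Y_*N)_{|\alpha}$ is the presheaf $(\rho:d\to c)\mapsto(Y_*N)_d(\alpha[\rho])$ on $\mathcal P/c$; a representation is $(c',\mathsf p,\mathsf q)$ with $\mathsf q\in(Y_*N)_{c'}(\alpha[\mathsf p])$ universal. -}

module Defs where

open import Level using (Level; 0ℓ; _⊔_) renaming (suc to lsuc)
open import Data.Product using (Σ; _,_; proj₁; proj₂; _×_; Σ-syntax)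
open import Relation.Binary.PropositionalEquality
open import Relation.Binary.PropositionalEquality.Properties
  using (subst-subst; subst-subst-sym)

isSet : ∀ {a} → Set a → Set a
isSet A = {x y : A} (p q : x ≡ y) → p ≡ q

record Category (o h : Level) : Set (lsuc (o ⊔ h)) where
  infixr 9 _∘_
  field
    Obj       : Set o
    Hom       : Obj → Obj → Set h
    id        : ∀ {A} → Hom A A
    _∘_       : ∀ {A B C} → Hom B C → Hom A B → Hom A C
    identityˡ : ∀ {A B} (f : Hom A B) → id ∘ f ≡ f
    identityʳ : ∀ {A B} (f : Hom A B) → f ∘ id ≡ f
    assoc     : ∀ {A B C D} (f : Hom C D) (g : Hom B C) (k : Hom A B) →
                (f ∘ g) ∘ k ≡ f ∘ (g ∘ k)
    Hom-isSet : ∀ {A B} → isSet (Hom A B)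

record Functor {o h o' h'} (C : Category o h) (D : Category o' h')
       : Set (o ⊔ h ⊔ o' ⊔ h') where
  field
    F₀   : Category.Obj C → Category.Obj D
    F₁   : ∀ {A B} → Category.Hom C A B → Category.Hom D (F₀ A) (F₀ B)
    F-id : ∀ {A} → F₁ (Category.id C {A}) ≡ Category.id D
    F-∘  : ∀ {A B E} (f : Category.Hom C B E) (g : Category.Hom C A B) →
           F₁ (Category._∘_ C f g) ≡ Category._∘_ D (F₁ f) (F₁ g)

IsIso : ∀ {o h} (S : Category o h) {A B : Category.Obj S} →
        Category.Hom S A B → Set h
IsIso S {A} {B} f =
  Σ[ g ∈ Category.Hom S B A ]
    ((Category._∘_ S g f ≡ Category.id S) × (Category._∘_ S f g ≡ Category.id S))

-- Presheaves on a small category C (values in Set ℓ), and ω-small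
-- dependent presheaves over a presheaf M (values in Set = ω-small sets)

record Presheaf {κ} (C : Category κ κ) (ℓ : Level) : Set (κ ⊔ lsuc ℓ) where
  open Category C
  field
    Ob       : Obj → Set ℓ
    Ob-isSet : ∀ {Θ} → isSet (Ob Θ)
    act      : ∀ {Θ Θ'} → Hom Θ' Θ → Ob Θ → Ob Θ'
    act-id   : ∀ {Θ} (x : Ob Θ) → act id x ≡ x
    act-∘    : ∀ {Θ Θ' Θ''} (σ : Hom Θ' Θ) (τ : Hom Θ'' Θ') (x : Ob Θ) →
               act (σ ∘ τ) x ≡ act τ (act σ x)

record DepPresheaf {κ} {C : Category κ κ} {ℓ} (M : Presheaf C ℓ) : Set (lsuc κ ⊔ ℓ) where
  open Category C
  private module M = Presheaf M
  field
    Ob       : (Θ : Obj) → M.Ob Θ → Set κ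
    Ob-isSet : ∀ {Θ x} → isSet (Ob Θ x)
    act      : ∀ {Θ Θ'} (σ : Hom Θ' Θ) {x : M.Ob Θ} → Ob Θ x → Ob Θ' (M.act σ x)
    act-id   : ∀ {Θ} {x : M.Ob Θ} (y : Ob Θ x) →
               subst (Ob Θ) (M.act-id x) (act id y) ≡ y
    act-∘    : ∀ {Θ Θ' Θ''} (σ : Hom Θ' Θ) (τ : Hom Θ'' Θ') {x : M.Ob Θ} (y : Ob Θ x) →
               subst (Ob Θ'') (M.act-∘ σ τ x) (act (σ ∘ τ) y) ≡ act τ (act σ y)

module Displayed {κ o} {C : Category κ κ} {S : Category o κ} (F : Functor C S) where
  private
    module C = Category C
    module S = Category S
  open Functor F

  idPath : ∀ {Θ Γ} (γ : S.Hom (F₀ Θ) Γ) → γ S.∘ F₁ (C.id {Θ}) ≡ γ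
  idPath γ = trans (cong (γ S.∘_) F-id) (S.identityʳ γ)

  ∘Path : ∀ {Θ Θ' Θ'' Γ} (γ : S.Hom (F₀ Θ) Γ) (σ : C.Hom Θ' Θ) (τ : C.Hom Θ'' Θ') →
          γ S.∘ F₁ (σ C.∘ τ) ≡ (γ S.∘ F₁ σ) S.∘ F₁ τ
  ∘Path γ σ τ = trans (cong (γ S.∘_) (F-∘ σ τ)) (sym (S.assoc γ (F₁ σ) (F₁ τ)))

  record PObj : Set (lsuc κ ⊔ o) where
    field
      ctx    : S.Obj
      fam    : (Θ : C.Obj) → S.Hom (F₀ Θ) ctx → Set κ
      act    : ∀ {Θ Θ'} (σ : C.Hom Θ' Θ) {γ : S.Hom (F₀ Θ) ctx} →
               fam Θ γ → fam Θ' (γ S.∘ F₁ σ)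
      act-id : ∀ {Θ} {γ : S.Hom (F₀ Θ) ctx} (x : fam Θ γ) →
               subst (fam Θ) (idPath γ) (act C.id x) ≡ x
      act-∘  : ∀ {Θ Θ' Θ''} (σ : C.Hom Θ' Θ) (τ : C.Hom Θ'' Θ')
               {γ : S.Hom (F₀ Θ) ctx} (x : fam Θ γ) →
               subst (fam Θ'') (∘Path γ σ τ) (act (σ C.∘ τ) x) ≡ act τ (act σ x)
  open PObj public

  record PHom (c d : PObj) : Set κ where
    field
      base : S.Hom (ctx c) (ctx d)
      map  : ∀ {Θ} {γ : S.Hom (F₀ Θ) (ctx c)} → fam c Θ γ → fam d Θ (base S.∘ γ)
      nat  : ∀ {Θ Θ'} (σ : C.Hom Θ' Θ) {γ : S.Hom (F₀ Θ) (ctx c)} (x : fam c Θ γ) →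
             subst (fam d Θ') (sym (S.assoc base γ (F₁ σ))) (map (act c σ x))
               ≡ act d σ (map x)
  open PHom public

  G₁ : ∀ {c d} → PHom c d → S.Hom (ctx c) (ctx d)
  G₁ = base

  infix 4 _≈P_
  record _≈P_ {c d : PObj} (f g : PHom c d) : Set κ where
    field
      base-≡ : base f ≡ base g
      map-≡  : ∀ {Θ} {γ : S.Hom (F₀ Θ) (ctx c)} (x : fam c Θ γ) →
               subst (fam d Θ) (cong (S._∘ γ) base-≡) (map f x) ≡ map g x

  private
    irr : ∀ {A B} {P : S.Hom A B → Set κ} {a b} (p q : a ≡ b) (y : P a) →
          subst P p y ≡ subst P q y
    irr {P = P} p q y = cong (λ r → subst P r y) (S.Hom-isSet p q)

    act-subst : ∀ (d : PObj) {Θ Θ'} (σ : C.Hom Θ' Θ) {γ γ'} (e : γ ≡ γ')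
                (y : fam d Θ γ) →
                act d σ (subst (fam d Θ) e y)
                  ≡ subst (fam d Θ') (cong (S._∘ F₁ σ) e) (act d σ y)
    act-subst d σ refl y = refl

    map-subst : ∀ {d e : PObj} (g : PHom d e) {Θ} {γ γ'} (p : γ ≡ γ')
                (y : fam d Θ γ) →
                map g (subst (fam d Θ) p y)
                  ≡ subst (fam e Θ) (cong (base g S.∘_) p) (map g y)
    map-subst g refl y = refl

    unnat : ∀ {c d : PObj} (f : PHom c d) {Θ Θ'} (σ : C.Hom Θ' Θ)
            {γ : S.Hom (F₀ Θ) (ctx c)} (x : fam c Θ γ) →
            map f (act c σ x)
              ≡ subst (fam d Θ') (S.assoc (base f) γ (F₁ σ)) (act d σ (map f x))
    unnat {d = d} f {Θ' = Θ'} σ {γ} x =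
      trans (sym (subst-subst-sym (S.assoc (base f) γ (F₁ σ))))
            (cong (subst (fam d Θ') (S.assoc (base f) γ (F₁ σ))) (nat f σ x))

  infixr 9 _∘P_
  _∘P_ : ∀ {c d e} → PHom d e → PHom c d → PHom c e
  _∘P_ {c} {d} {e} g f = record
    { base = base g S.∘ base f
    ; map  = λ {Θ} {γ} x →
        subst (fam e Θ) (sym (S.assoc (base g) (base f) γ)) (map g (map f x))
    ; nat  = λ {Θ} {Θ'} σ {γ} x →
        let z  = act e σ (map g (map f x))
            P' = fam e Θ'
            A  = sym (S.assoc (base g S.∘ base f) γ (F₁ σ))
            B  = sym (S.assoc (base g) (base f) (γ S.∘ F₁ σ))
            C₁ = cong (base g S.∘_) (S.assoc (base f) γ (F₁ σ))
            C₂ = S.assoc (base g) (base f S.∘ γ) (F₁ σ)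
            D  = cong (S._∘ F₁ σ) (sym (S.assoc (base g) (base f) γ))
        in begin
          subst P' A (subst P' B (map g (map f (act c σ x))))
            ≡⟨ cong (λ w → subst P' A (subst P' B (map g w))) (unnat f σ x) ⟩
          subst P' A (subst P' B (map g (subst (fam d Θ')
              (S.assoc (base f) γ (F₁ σ)) (act d σ (map f x)))))
            ≡⟨ cong (λ w → subst P' A (subst P' B w))
                    (map-subst g (S.assoc (base f) γ (F₁ σ)) (act d σ (map f x))) ⟩
          subst P' A (subst P' B (subst P' C₁ (map g (act d σ (map f x)))))
            ≡⟨ cong (λ w → subst P' A (subst P' B (subst P' C₁ w))) (unnat g σ (map f x)) ⟩
          subst P' A (subst P' B (subst P' C₁ (subst P' C₂ z)))
            ≡⟨ cong (λ w → subst P' A (subst P' B w)) (subst-subst C₂) ⟩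
          subst P' A (subst P' B (subst P' (trans C₂ C₁) z))
            ≡⟨ cong (subst P' A) (subst-subst (trans C₂ C₁)) ⟩
          subst P' A (subst P' (trans (trans C₂ C₁) B) z)
            ≡⟨ subst-subst (trans (trans C₂ C₁) B) ⟩
          subst P' (trans (trans (trans C₂ C₁) B) A) z
            ≡⟨ irr (trans (trans (trans C₂ C₁) B) A) D z ⟩
          subst P' D z
            ≡⟨ sym (act-subst e σ (sym (S.assoc (base g) (base f) γ)) (map g (map f x))) ⟩
          act e σ (subst (fam e Θ) (sym (S.assoc (base g) (base f) γ)) (map g (map f x)))
            ∎
    }
    where open ≡-Reasoning

  private
    fib₁-subst : ∀ {Θ Γ} {γ γ' : S.Hom (F₀ Θ) (F₀ Γ)} (p : γ ≡ γ')
                 (x : Σ[ ρ ∈ C.Hom Θ Γ ] F₁ ρ ≡ γ) →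
                 proj₁ (subst (λ δ → Σ[ ρ ∈ C.Hom Θ Γ ] F₁ ρ ≡ δ) p x) ≡ proj₁ x
    fib₁-subst refl x = refl

    fib-≡ : ∀ {Θ Γ} {γ : S.Hom (F₀ Θ) (F₀ Γ)} {x y : Σ[ ρ ∈ C.Hom Θ Γ ] F₁ ρ ≡ γ} →
            proj₁ x ≡ proj₁ y → x ≡ y
    fib-≡ {x = ρ , e} {.ρ , e'} refl = cong (ρ ,_) (S.Hom-isSet e e')

  Y₀ : C.Obj → PObj
  Y₀ Γ = record
    { ctx    = F₀ Γ
    ; fam    = λ Θ γ → Σ[ ρ ∈ C.Hom Θ Γ ] F₁ ρ ≡ γ
    ; act    = λ σ {γ} x → proj₁ x C.∘ σ , trans (F-∘ (proj₁ x) σ) (cong (S._∘ F₁ σ) (proj₂ x))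
    ; act-id = λ {Θ} {γ} x → fib-≡ (trans (fib₁-subst (idPath γ) _) (C.identityʳ (proj₁ x)))
    ; act-∘  = λ σ τ {γ} x → fib-≡ (trans (fib₁-subst (∘Path γ σ τ) _)
                                         (sym (C.assoc (proj₁ x) σ τ)))
    }

  Y₁ : ∀ {Θ' Θ} → C.Hom Θ' Θ → PHom (Y₀ Θ') (Y₀ Θ)
  Y₁ σ = record
    { base = F₁ σ
    ; map  = λ {Ξ} {γ} x → σ C.∘ proj₁ x , trans (F-∘ σ (proj₁ x)) (cong (F₁ σ S.∘_) (proj₂ x))
    ; nat  = λ τ {γ} x → fib-≡ (trans (fib₁-subst (sym (S.assoc (F₁ σ) γ (F₁ τ))) _)
                                      (sym (C.assoc σ (proj₁ x) τ)))
    }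

  Fam : ∀ {ℓ} → Presheaf C ℓ → PObj → Set (ℓ ⊔ κ)
  Fam M c = (Θ : C.Obj) → PHom (Y₀ Θ) c → Presheaf.Ob M Θ

  restrict : ∀ {ℓ} {M : Presheaf C ℓ} {c d : PObj} → Fam M c → PHom d c → Fam M d
  restrict α ρ Θ u = α Θ (ρ ∘P u)

  record YStarM {ℓ} (M : Presheaf C ℓ) (c : PObj) : Set (ℓ ⊔ κ) where
    field
      el     : Fam M c
      el-resp : ∀ {Θ} {u u' : PHom (Y₀ Θ) c} → u ≈P u' → el Θ u ≡ el Θ u'
      el-nat : ∀ {Θ Θ'} (σ : C.Hom Θ' Θ) (u : PHom (Y₀ Θ) c) →
               el Θ' (u ∘P Y₁ σ) ≡ Presheaf.act M σ (el Θ u)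

  -- Dependent equalities
  -- are stated by transport along any proof of the equality of indices
  -- (M takes values in sets, so this is the same as along one proof).
  record YStarN {ℓ} {M : Presheaf C ℓ} (N : DepPresheaf M) (c : PObj) (α : Fam M c)
         : Set (ℓ ⊔ κ) where
    field
      el      : (Θ : C.Obj) (u : PHom (Y₀ Θ) c) → DepPresheaf.Ob N Θ (α Θ u)
      el-resp : ∀ {Θ} {u u' : PHom (Y₀ Θ) c} → u ≈P u' →
                (e : α Θ u ≡ α Θ u') →
                subst (DepPresheaf.Ob N Θ) e (el Θ u) ≡ el Θ u'
      el-nat  : ∀ {Θ Θ'} (σ : C.Hom Θ' Θ) (u : PHom (Y₀ Θ) c) →
                (e : α Θ' (u ∘P Y₁ σ) ≡ Presheaf.act M σ (α Θ u)) →
                subst (DepPresheaf.Ob N Θ') e (el Θ' (u ∘P Y₁ σ))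
                  ≡ DepPresheaf.act N σ (el Θ u)

  record Representation {ℓ} {M : Presheaf C ℓ} (N : DepPresheaf M)
         (c : PObj) (α : YStarM M c) : Set (lsuc κ ⊔ ℓ ⊔ o) where
    private α₀ = YStarM.el α
    field
      c' : PObj
      p  : PHom c' c
      q  : YStarN N c' (restrict {M = M} α₀ p)
    -- k : (d , ρ) → (c' , p) in P/c, and q[k] = x
    IsFactor : {d : PObj} (ρ : PHom d c) (x : YStarN N d (restrict {M = M} α₀ ρ)) →
               PHom d c' → Set (κ ⊔ ℓ)
    IsFactor {d} ρ x k =
      (p ∘P k ≈P ρ) ×
      (∀ {Θ} (u : PHom (Y₀ Θ) d) (e : α₀ Θ (p ∘P (k ∘P u)) ≡ α₀ Θ (ρ ∘P u)) →
         subst (DepPresheaf.Ob N Θ) e (YStarN.el q Θ (k ∘P u)) ≡ YStarN.el x Θ u)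
    field
      universal : (d : PObj) (ρ : PHom d c) (x : YStarN N d (restrict {M = M} α₀ ρ)) →
                  Σ[ k ∈ PHom d c' ] (IsFactor ρ x k ×
                    ((k' : PHom d c') → IsFactor ρ x k' → k' ≈P k))

open Displayed public

module Submission where

open import Level using (Level; Lift; lower)
open import Data.Empty using (⊥; ⊥-elim)
open import Data.Product using (Σ; _,_)
open import Relation.Binary.PropositionalEquality
open import Defs

-- Over every X ∈ S there is the object (X, ∅) of P with empty
-- fibres.  No representable YΘ maps into it, so (Y_* N) over it has exactly
-- one (vacuous) element, and a map (X, ∅) → c' over c is just a map
-- X → G c' over G c.  The universal property of (c', p, q), tested on these
-- objects, makes G p split epi (X = G c) and mono (X arbitrary).

sectionOfMono⇒isIso : ∀ {o h} (S : Category o h) {A B : Category.Obj S}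
                      {p : Category.Hom S A B} (s : Category.Hom S B A) →
                      let open Category S in
                      p ∘ s ≡ id →
                      (∀ {X} (f g : Hom X A) → p ∘ f ≡ p ∘ g → f ≡ g) →
                      IsIso S p
sectionOfMono⇒isIso S {p = p} s ps≡id p-mono =
  s , p-mono (s ∘ p) id p∘sp≡p∘id , ps≡id
  where
  open Category S
  open ≡-Reasoning
  p∘sp≡p∘id : p ∘ (s ∘ p) ≡ p ∘ id
  p∘sp≡p∘id = begin
    p ∘ (s ∘ p)  ≡⟨ sym (assoc p s p) ⟩
    (p ∘ s) ∘ p  ≡⟨ cong (_∘ p) ps≡id ⟩
    id ∘ p       ≡⟨ identityˡ p ⟩
    p            ≡⟨ sym (identityʳ p) ⟩
    p ∘ id       ∎

module _ {κ o} {C : Category κ κ} {S : Category o κ} (F : Functor C S) where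
  private
    module C = Category C
    module S = Category S
  open Functor F

  emptyFibre : S.Obj → PObj F
  emptyFibre X = record
    { ctx    = X
    ; fam    = λ _ _ → Lift κ ⊥
    ; act    = λ _ ()
    ; act-id = λ ()
    ; act-∘  = λ _ _ ()
    }

  fromEmptyFibre : ∀ {X} {d : PObj F} → S.Hom X (ctx d) → PHom F (emptyFibre X) d
  fromEmptyFibre b = record { base = b ; map = λ () ; nat = λ _ () }

  Y₀⇏emptyFibre : ∀ {X Θ} → PHom F (Y₀ F Θ) (emptyFibre X) → ⊥
  Y₀⇏emptyFibre u = lower (map u {γ = F₁ C.id} (C.id , refl))

  emptySection : ∀ {ℓ} {M : Presheaf C ℓ} (N : DepPresheaf M) {X}
                 (β : Fam F M (emptyFibre X)) → YStarN F N (emptyFibre X) β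
  emptySection N β = record
    { el      = λ _ u → ⊥-elim (Y₀⇏emptyFibre u)
    ; el-resp = λ {_} {u} _ _ → ⊥-elim (Y₀⇏emptyFibre u)
    ; el-nat  = λ _ u _ → ⊥-elim (Y₀⇏emptyFibre u)
    }

  module _ {ℓ} {M : Presheaf C ℓ} {N : DepPresheaf M} {c : PObj F}
           {α : YStarM F M c} (r : Representation F N c α) where
    open Representation r

    isFactor-fromEmptyFibre : ∀ {X} {b : S.Hom X (ctx c')} {b' : S.Hom X (ctx c)} →
      base p S.∘ b ≡ b' →
      (x : YStarN F N (emptyFibre X) (restrict F {M = M} (YStarM.el α) (fromEmptyFibre b'))) →
      IsFactor (fromEmptyFibre b') x (fromEmptyFibre b)
    isFactor-fromEmptyFibre pb≡b' x =
      record { base-≡ = pb≡b' ; map-≡ = λ () } , λ u _ → ⊥-elim (Y₀⇏emptyFibre u)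

    G₁p-section : Σ (S.Hom (ctx c) (ctx c')) λ s → base p S.∘ s ≡ S.id
    G₁p-section with universal _ (fromEmptyFibre S.id) (emptySection N _)
    ... | k , (pk≈id , _) , _ = base k , _≈P_.base-≡ pk≈id

    G₁p-mono : ∀ {X} (f g : S.Hom X (ctx c')) → base p S.∘ f ≡ base p S.∘ g → f ≡ g
    G₁p-mono f g pf≡pg
      with universal _ (fromEmptyFibre (base p S.∘ f)) (emptySection N _)
    ... | k , _ , unique = trans (base-≡ f≈k) (sym (base-≡ g≈k))
      where
      open _≈P_
      f≈k : _≈P_ F (fromEmptyFibre f) k
      f≈k = unique _ (isFactor-fromEmptyFibre refl (emptySection N _))
      g≈k : _≈P_ F (fromEmptyFibre g) k
      g≈k = unique _ (isFactor-fromEmptyFibre (sym pf≡pg) (emptySection N _))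

proposition30 : ∀ {κ o ℓ : Level} (C : Category κ κ) (S : Category o κ) (F : Functor C S)
                (M : Presheaf C ℓ) (N : DepPresheaf M)
                (c : PObj F) (α : YStarM F M c) (r : Representation F N c α) →
                IsIso S (G₁ F (Representation.p r))
proposition30 C S F M N c α r with G₁p-section F r
... | s , ps≡id = sectionOfMono⇒isIso S s ps≡id (G₁p-mono F r)
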